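{- Let $n\ge1$, $d$ a positive divisor of $n$, $C$ the cyclic shift $C(x_0,\dots,x_{n-1})=(x_1,\dots,x_{n-1},x_0)$ on $\mathbb{Z}_2^n$, $X=(-1,+1,\dots,+1)$, $A_{i,d}X=\prod_{j=0}^{n/d-1}C^{i+jd}X$ for $0\le i\le d-1$, and $\mathbb{G}_d(n)$ the subgroup of $\mathbb{Z}_2^n$ generated by $\{A_{0,d}X,\dots,A_{d-1,d}X\}$. For $0\le a\le n$ let $\mathcal{G}_n(a)$ be the set of $Y\in\mathbb{Z}_2^n$ with exactly $a$ coordinates equal to $+1$. Then $$\mathbb{G}_d(n)\subseteq\bigcup_{a=0}^{d}\mathcal{G}_n\!\left(\tfrac{na}{d}\right),$$ with equality holding only for $d=1$ and $d=n$.
   Context: $\mathbb{Z}_2^n$ is the group of $\pm1$ sequences of length $n$ under coordinatewise multiplication. -}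

module Defs where

open import Data.Nat using (ℕ; zero; suc; _+_; _*_; _/_; _<_; _≤_; NonZero)
open import Data.Vec using (Vec; []; _∷_; _∷ʳ_; replicate; zipWith)
open import Data.List using (List; map; foldr; upTo)
open import Data.Product using (∃; _×_)
open import Relation.Binary.PropositionalEquality using (_≡_)

data Sign : Set where
  plus  : Sign
  minus : Sign

_·_ : Sign → Sign → Sign
plus  · s = s
minus · plus  = minus
minus · minus = plus

Z2^ : ℕ → Set
Z2^ n = Vec Sign n

_⊙_ : ∀ {n} → Z2^ n → Z2^ n → Z2^ n
_⊙_ = zipWith _·_

one : ∀ n → Z2^ n
one n = replicate n plus

inv : ∀ {n} → Z2^ n → Z2^ n
inv x = x   -- every element of Z_2^n is its own inverse (kept for the subgroup definition)

C : ∀ {n} → Z2^ n → Z2^ n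
C []       = []
C (x ∷ xs) = xs ∷ʳ x

Cpow : ∀ {n} → ℕ → Z2^ n → Z2^ n
Cpow zero    x = x
Cpow (suc m) x = C (Cpow m x)

X : ∀ n → Z2^ n
X zero    = []
X (suc m) = minus ∷ replicate m plus

prod : ∀ {n} → List (Z2^ n) → Z2^ n
prod {n} = foldr _⊙_ (one n)

A : (n d : ℕ) .{{_ : NonZero d}} → ℕ → Z2^ n
A n d i = prod (map (λ j → Cpow (i + j * d) (X n)) (upTo (n / d)))

data 𝔾 (n d : ℕ) .{{_ : NonZero d}} : Z2^ n → Set where
  gen : ∀ i → i < d → 𝔾 n d (A n d i)
  unit : 𝔾 n d (one n)
  mul : ∀ {x y} → 𝔾 n d x → 𝔾 n d y → 𝔾 n d (x ⊙ y)
  inverse : ∀ {x} → 𝔾 n d x → 𝔾 n d (inv x)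

countPlus : ∀ {n} → Z2^ n → ℕ
countPlus []           = 0
countPlus (plus ∷ xs)  = suc (countPlus xs)
countPlus (minus ∷ xs) = countPlus xs

𝒢 : (n a : ℕ) → Z2^ n → Set
𝒢 n a Y = countPlus Y ≡ a

UnionG : (n d : ℕ) .{{_ : NonZero d}} → Z2^ n → Set
UnionG n d Y = ∃ λ a → a ≤ d × 𝒢 n ((n * a) / d) Y

-- Every generator A_{i,d}X is invariant under C^d: the shift by d permutes its factors cyclically,
-- using C^n = id. Hence so is all of 𝔾_d(n), and a C^d-invariant sequence of length n = qd is q
-- copies of a block b of length d, so it has q·a = na/d coordinates +1, where a ≤ d counts the +1
-- in b. Conversely, for 2 ≤ d < n the sequence of q minus signs followed by plus signs has
-- q(d-1) coordinates +1 but is not of that form: its block would begin with two minus signs. For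
-- d = 1 the union is {1, -1} and A_{0,1}X = -1; for d = n the generators C^iX give every sequence
-- with a single -1, and these span ℤ₂ⁿ.
module Submission where

open import Defs
open import Data.Nat using (ℕ; zero; suc; _+_; _*_; _∸_; _/_; _≤_; _<_; z≤n; s≤s; NonZero; ≢-nonZero⁻¹)
open import Data.Nat.Properties
open import Data.Nat.Divisibility using (_∣_; divides; 1∣_)
open import Data.Nat.DivMod using (m*n/n≡m; m/n*n≡m; n/n≡1; n/1≡n)
open import Data.List as List using (List; []; _∷_; _++_; length; map; concat; upTo; applyUpTo)
open import Data.List.Properties
  using (++-assoc; ++-identityʳ; map-∘; map-cong; map-upTo; applyUpTo-∷ʳ; ∷-injective)
open import Data.List.Relation.Unary.All as All using (All)
open import Data.List.Relation.Unary.All.Properties using (map⁺; applyUpTo⁺₁)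
open import Data.Vec as Vec using (Vec; _∷ʳ_; replicate; toList; head)
import Data.Vec.Properties as Vecₚ
open import Data.Vec.Relation.Binary.Equality.Cast using (cast-is-id)
open import Data.Product using (∃; ∃₂; _×_; _,_)
open import Data.Sum using (_⊎_; inj₁; inj₂)
open import Data.Empty using (⊥-elim)
open import Function using (_∘_)
open import Relation.Nullary using (¬_; yes; no)
open import Relation.Binary.PropositionalEquality

private variable
  T : Set
  n : ℕ

·-comm : ∀ a b → a · b ≡ b · a
·-comm plus  plus  = refl
·-comm plus  minus = refl
·-comm minus plus  = refl
·-comm minus minus = refl

·-assoc : ∀ a b c → (a · b) · c ≡ a · (b · c)
·-assoc plus  b     c    = refl
·-assoc minus plus  c    = refl
·-assoc minus minus plus  = refl
·-assoc minus minus minus = refl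

·-identityʳ : ∀ a → a · plus ≡ a
·-identityʳ plus  = refl
·-identityʳ minus = refl

⊙-comm : (x y : Z2^ n) → x ⊙ y ≡ y ⊙ x
⊙-comm = Vecₚ.zipWith-comm ·-comm

⊙-assoc : (x y z : Z2^ n) → (x ⊙ y) ⊙ z ≡ x ⊙ (y ⊙ z)
⊙-assoc = Vecₚ.zipWith-assoc ·-assoc

⊙-identityˡ : (x : Z2^ n) → one n ⊙ x ≡ x
⊙-identityˡ = Vecₚ.zipWith-identityˡ (λ _ → refl)

⊙-identityʳ : (x : Z2^ n) → x ⊙ one n ≡ x
⊙-identityʳ = Vecₚ.zipWith-identityʳ ·-identityʳ

head-⊙ : (x y : Z2^ (suc n)) → head (x ⊙ y) ≡ head x · head y
head-⊙ (a Vec.∷ x) (b Vec.∷ y) = refl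

prod-∷ʳ : (l : List (Z2^ n)) (x : Z2^ n) → prod (l List.∷ʳ x) ≡ prod l ⊙ x
prod-∷ʳ []      x = trans (⊙-identityʳ x) (sym (⊙-identityˡ x))
prod-∷ʳ (y ∷ l) x = trans (cong (y ⊙_) (prod-∷ʳ l x)) (sym (⊙-assoc y (prod l) x))

prod-applyUpTo-shift : ∀ (g : ℕ → Z2^ n) p → g p ≡ g 0 →
                       prod (applyUpTo (g ∘ suc) p) ≡ prod (applyUpTo g p)
prod-applyUpTo-shift g zero    _     = refl
prod-applyUpTo-shift g (suc p) gp≡g0 = begin
  prod (applyUpTo (g ∘ suc) (suc p))            ≡⟨ cong prod (applyUpTo-∷ʳ (g ∘ suc) p) ⟨
  prod (applyUpTo (g ∘ suc) p List.∷ʳ g (suc p)) ≡⟨ prod-∷ʳ (applyUpTo (g ∘ suc) p) (g (suc p)) ⟩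
  prod (applyUpTo (g ∘ suc) p) ⊙ g (suc p)       ≡⟨ cong (prod (applyUpTo (g ∘ suc) p) ⊙_) gp≡g0 ⟩
  prod (applyUpTo (g ∘ suc) p) ⊙ g 0             ≡⟨ ⊙-comm _ (g 0) ⟩
  g 0 ⊙ prod (applyUpTo (g ∘ suc) p)             ∎
  where open ≡-Reasoning

head-prod-plus : (l : List (Z2^ (suc n))) → All (λ v → head v ≡ plus) l → head (prod l) ≡ plus
head-prod-plus []      All.[]        = refl
head-prod-plus (x ∷ l) (hx All.∷ hl) = trans (head-⊙ x (prod l)) (cong₂ _·_ hx (head-prod-plus l hl))

∷ʳ-⊙ : (x y : Z2^ n) (a b : Sign) → (x ∷ʳ a) ⊙ (y ∷ʳ b) ≡ (x ⊙ y) ∷ʳ (a · b)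
∷ʳ-⊙ Vec.[]      Vec.[]      a b = refl
∷ʳ-⊙ (c Vec.∷ x) (e Vec.∷ y) a b = cong ((c · e) Vec.∷_) (∷ʳ-⊙ x y a b)

replicate-∷ʳ : ∀ n (a : T) → replicate n a ∷ʳ a ≡ a Vec.∷ replicate n a
replicate-∷ʳ zero    a = refl
replicate-∷ʳ (suc n) a = cong (a Vec.∷_) (replicate-∷ʳ n a)

∷ʳ≡∷⇒replicate : (x : Vec T n) (a : T) → x ∷ʳ a ≡ a Vec.∷ x → x ≡ replicate n a
∷ʳ≡∷⇒replicate Vec.[]      a _  = refl
∷ʳ≡∷⇒replicate (b Vec.∷ x) a eq with Vecₚ.∷-injective eq
... | refl , x∷ʳa≡a∷x = cong (a Vec.∷_) (∷ʳ≡∷⇒replicate x a x∷ʳa≡a∷x)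

C-⊙ : (x y : Z2^ n) → C (x ⊙ y) ≡ C x ⊙ C y
C-⊙ Vec.[]      Vec.[]      = refl
C-⊙ (a Vec.∷ x) (b Vec.∷ y) = sym (∷ʳ-⊙ x y a b)

C-one : ∀ n → C (one n) ≡ one n
C-one zero    = refl
C-one (suc n) = replicate-∷ʳ n plus

C-fixed⇒constant : (x : Z2^ (suc n)) → C x ≡ x → x ≡ replicate (suc n) (head x)
C-fixed⇒constant (a Vec.∷ x) Cx≡x = cong (a Vec.∷_) (∷ʳ≡∷⇒replicate x a Cx≡x)

Cpow-⊙ : ∀ m (x y : Z2^ n) → Cpow m (x ⊙ y) ≡ Cpow m x ⊙ Cpow m y
Cpow-⊙ zero    x y = refl
Cpow-⊙ (suc m) x y = trans (cong C (Cpow-⊙ m x y)) (C-⊙ (Cpow m x) (Cpow m y))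

Cpow-one : ∀ n m → Cpow m (one n) ≡ one n
Cpow-one n zero    = refl
Cpow-one n (suc m) = trans (cong C (Cpow-one n m)) (C-one n)

Cpow-prod : ∀ m (l : List (Z2^ n)) → Cpow m (prod l) ≡ prod (map (Cpow m) l)
Cpow-prod {n} m []      = Cpow-one n m
Cpow-prod     m (x ∷ l) = trans (Cpow-⊙ m x (prod l)) (cong (Cpow m x ⊙_) (Cpow-prod m l))

Cpow-+ : ∀ a b (x : Z2^ n) → Cpow (a + b) x ≡ Cpow a (Cpow b x)
Cpow-+ zero    b x = refl
Cpow-+ (suc a) b x = cong C (Cpow-+ a b x)

rotate : List T → List T
rotate []      = []
rotate (x ∷ l) = l List.∷ʳ x

rotateN : ℕ → List T → List T
rotateN zero    l = l
rotateN (suc m) l = rotate (rotateN m l)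

rotateN-rotate : ∀ m (l : List T) → rotateN m (rotate l) ≡ rotate (rotateN m l)
rotateN-rotate zero    l = refl
rotateN-rotate (suc m) l = cong rotate (rotateN-rotate m l)

rotateN-++ : (b r : List T) → rotateN (length b) (b ++ r) ≡ r ++ b
rotateN-++ []      r = sym (++-identityʳ r)
rotateN-++ (x ∷ b) r = begin
  rotate (rotateN (length b) (x ∷ b ++ r))   ≡⟨ rotateN-rotate (length b) (x ∷ b ++ r) ⟨
  rotateN (length b) ((b ++ r) List.∷ʳ x)   ≡⟨ cong (rotateN (length b)) (++-assoc b r List.[ x ]) ⟩
  rotateN (length b) (b ++ (r List.∷ʳ x))   ≡⟨ rotateN-++ b (r List.∷ʳ x) ⟩
  (r List.∷ʳ x) ++ b                        ≡⟨ ++-assoc r List.[ x ] b ⟩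
  r ++ x ∷ b                                ∎
  where open ≡-Reasoning

toList-Cpow : ∀ m (x : Z2^ n) → toList (Cpow m x) ≡ rotateN m (toList x)
toList-Cpow zero    x = refl
toList-Cpow (suc m) x = trans (toList-C (Cpow m x)) (cong rotate (toList-Cpow m x))
  where
  toList-C : (y : Z2^ n) → toList (C y) ≡ rotate (toList y)
  toList-C Vec.[]      = refl
  toList-C (a Vec.∷ y) = Vecₚ.toList-∷ʳ a y

Cpow-n≡id : (x : Z2^ n) → Cpow n x ≡ x
Cpow-n≡id {n} x = trans (sym (cast-is-id refl (Cpow n x)))
                        (Vecₚ.toList-injective refl (Cpow n x) x (begin
  toList (Cpow n x)                      ≡⟨ toList-Cpow n x ⟩
  rotateN n (toList x)                   ≡⟨ cong (λ k → rotateN k (toList x)) (Vecₚ.length-toList x) ⟨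
  rotateN (length (toList x)) (toList x) ≡⟨ rotateN-length (toList x) ⟩
  toList x                               ∎))
  where
  open ≡-Reasoning
  rotateN-length : (l : List Sign) → rotateN (length l) l ≡ l
  rotateN-length l = trans (cong (rotateN (length l)) (sym (++-identityʳ l))) (rotateN-++ l [])

Invariant : ℕ → Z2^ n → Set
Invariant d x = Cpow d x ≡ x

A-invariant : (n d : ℕ) .{{_ : NonZero d}} → d ∣ n → ∀ i → Invariant d (A n d i)
A-invariant n d d∣n i = begin
  Cpow d (prod (map h (upTo q)))          ≡⟨ Cpow-prod d (map h (upTo q)) ⟩
  prod (map (Cpow d) (map h (upTo q)))    ≡⟨ cong prod (map-∘ (upTo q)) ⟨
  prod (map (Cpow d ∘ h) (upTo q))        ≡⟨ cong prod (map-cong Cpow-d-h (upTo q)) ⟩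
  prod (map (h ∘ suc) (upTo q))           ≡⟨ cong prod (map-upTo (h ∘ suc) q) ⟩
  prod (applyUpTo (h ∘ suc) q)            ≡⟨ prod-applyUpTo-shift h q hq≡h0 ⟩
  prod (applyUpTo h q)                    ≡⟨ cong prod (map-upTo h q) ⟨
  prod (map h (upTo q))                   ∎
  where
  open ≡-Reasoning
  q : ℕ
  q = n / d
  h : ℕ → Z2^ n
  h j = Cpow (i + j * d) (X n)
  Cpow-d-h : ∀ j → Cpow d (h j) ≡ h (suc j)
  Cpow-d-h j = begin
    Cpow d (Cpow (i + j * d) (X n)) ≡⟨ Cpow-+ d (i + j * d) (X n) ⟨
    Cpow (d + (i + j * d)) (X n)    ≡⟨ cong (λ k → Cpow k (X n)) (+-comm d (i + j * d)) ⟩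
    Cpow ((i + j * d) + d) (X n)    ≡⟨ cong (λ k → Cpow k (X n)) (+-assoc i (j * d) d) ⟩
    Cpow (i + (j * d + d)) (X n)    ≡⟨ cong (λ k → Cpow (i + k) (X n)) (+-comm (j * d) d) ⟩
    Cpow (i + suc j * d) (X n)      ∎
  hq≡h0 : h q ≡ h 0
  hq≡h0 = begin
    Cpow (i + q * d) (X n)  ≡⟨ cong (λ k → Cpow (i + k) (X n)) (m/n*n≡m d∣n) ⟩
    Cpow (i + n) (X n)      ≡⟨ Cpow-+ i n (X n) ⟩
    Cpow i (Cpow n (X n))   ≡⟨ cong (Cpow i) (Cpow-n≡id (X n)) ⟩
    Cpow i (X n)            ≡⟨ cong (λ k → Cpow k (X n)) (+-identityʳ i) ⟨
    Cpow (i + 0) (X n)      ∎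

𝔾⇒invariant : ∀ {n d} .{{_ : NonZero d}} → d ∣ n → ∀ {x} → 𝔾 n d x → Invariant d x
𝔾⇒invariant {n} {d} d∣n (gen i _)            = A-invariant n d d∣n i
𝔾⇒invariant {n} {d} d∣n unit                 = Cpow-one n d
𝔾⇒invariant {d = d} d∣n (mul {x} {y} gx gy) =
  trans (Cpow-⊙ d x y) (cong₂ _⊙_ (𝔾⇒invariant d∣n gx) (𝔾⇒invariant d∣n gy))
𝔾⇒invariant d∣n (inverse gx)                 = 𝔾⇒invariant d∣n gx

splitAt-length : ∀ d m (l : List T) → length l ≡ d + m →
                 ∃₂ λ b r → length b ≡ d × length r ≡ m × l ≡ b ++ r
splitAt-length zero    m l       |l|≡m = [] , l , refl , |l|≡m , refl
splitAt-length (suc d) m (x ∷ l) |l|≡d+m with splitAt-length d m l (suc-injective |l|≡d+m)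
... | b , r , |b|≡d , |r|≡m , refl = x ∷ b , r , cong suc |b|≡d , |r|≡m , refl

++-injective : (a b x y : List T) → length a ≡ length b → a ++ x ≡ b ++ y → a ≡ b × x ≡ y
++-injective []      []      x y _      eq = refl , eq
++-injective (u ∷ a) (v ∷ b) x y |a|≡|b| eq with ∷-injective eq
... | refl , a++x≡b++y with ++-injective a b x y (suc-injective |a|≡|b|) a++x≡b++y
... | refl , x≡y = refl , x≡y

commute⇒replicate : ∀ d k (b r : List T) → length b ≡ d → length r ≡ k * d →
                    r ++ b ≡ b ++ r → r ≡ concat (List.replicate k b)
commute⇒replicate d zero    b []  _     _      _        = refl
commute⇒replicate d (suc k) b r  |b|≡d |r|≡kd+d r++b≡b++r
  with splitAt-length d (k * d) r |r|≡kd+d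
... | b′ , r′ , |b′|≡d , |r′|≡kd , refl
  with ++-injective b′ b (r′ ++ b) (b′ ++ r′) (trans |b′|≡d (sym |b|≡d))
         (trans (sym (++-assoc b′ r′ b)) r++b≡b++r)
... | refl , r′++b≡b++r′ = cong (b ++_) (commute⇒replicate d k b r′ |b|≡d |r′|≡kd r′++b≡b++r′)

rotateN-invariant⇒periodic : ∀ d q (l : List T) → length l ≡ suc q * d → rotateN d l ≡ l →
                             ∃ λ b → length b ≡ d × l ≡ concat (List.replicate (suc q) b)
rotateN-invariant⇒periodic d q l |l|≡d+qd rotl≡l with splitAt-length d (q * d) l |l|≡d+qd
... | b , r , |b|≡d , |r|≡qd , refl =
  b , |b|≡d , cong (b ++_) (commute⇒replicate d q b r |b|≡d |r|≡qd r++b≡b++r)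
  where
  r++b≡b++r : r ++ b ≡ b ++ r
  r++b≡b++r = trans (sym (subst (λ k → rotateN k (b ++ r) ≡ r ++ b) |b|≡d (rotateN-++ b r))) rotl≡l

plusCount : List Sign → ℕ
plusCount []          = 0
plusCount (plus ∷ l)  = suc (plusCount l)
plusCount (minus ∷ l) = plusCount l

plusCount-++ : ∀ a b → plusCount (a ++ b) ≡ plusCount a + plusCount b
plusCount-++ []          b = refl
plusCount-++ (plus ∷ a)  b = cong suc (plusCount-++ a b)
plusCount-++ (minus ∷ a) b = plusCount-++ a b

plusCount-replicate : ∀ q b → plusCount (concat (List.replicate q b)) ≡ q * plusCount b
plusCount-replicate zero    b = refl
plusCount-replicate (suc q) b =
  trans (plusCount-++ b _) (cong (plusCount b +_) (plusCount-replicate q b))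

plusCount≤length : ∀ b → plusCount b ≤ length b
plusCount≤length []          = z≤n
plusCount≤length (plus ∷ b)  = s≤s (plusCount≤length b)
plusCount≤length (minus ∷ b) = m≤n⇒m≤1+n (plusCount≤length b)

countPlus≡plusCount : (x : Z2^ n) → countPlus x ≡ plusCount (toList x)
countPlus≡plusCount Vec.[]          = refl
countPlus≡plusCount (plus Vec.∷ x)  = cong suc (countPlus≡plusCount x)
countPlus≡plusCount (minus Vec.∷ x) = countPlus≡plusCount x

invariant⇒periodic : ∀ q d (Y : Z2^ (suc q * d)) → Invariant d Y →
                     ∃ λ b → length b ≡ d × toList Y ≡ concat (List.replicate (suc q) b)
invariant⇒periodic q d Y CᵈY≡Y = rotateN-invariant⇒periodic d q (toList Y) (Vecₚ.length-toList Y)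
  (trans (sym (toList-Cpow d Y)) (cong toList CᵈY≡Y))

countPlus-periodic : ∀ q b (Y : Z2^ n) → toList Y ≡ concat (List.replicate q b) →
                     countPlus Y ≡ q * plusCount b
countPlus-periodic q b Y Y≡bᵠ =
  trans (countPlus≡plusCount Y) (trans (cong plusCount Y≡bᵠ) (plusCount-replicate q b))

[q*d]*a/d≡q*a : ∀ q d a .{{_ : NonZero d}} → q * d * a / d ≡ q * a
[q*d]*a/d≡q*a q d a = trans (cong (_/ d) (begin
  q * d * a   ≡⟨ *-assoc q d a ⟩
  q * (d * a) ≡⟨ cong (q *_) (*-comm d a) ⟩
  q * (a * d) ≡⟨ *-assoc q a d ⟨
  q * a * d   ∎)) (m*n/n≡m (q * a) d)
  where open ≡-Reasoning

𝔾⊆UnionG : (n d : ℕ) .{{_ : NonZero d}} → 1 ≤ n → d ∣ n → (Y : Z2^ n) → 𝔾 n d Y → UnionG n d Y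
𝔾⊆UnionG .0 d () (divides zero refl)
𝔾⊆UnionG .(suc q * d) d _ d∣n@(divides (suc q) refl) Y Y∈𝔾
  with invariant⇒periodic q d Y (𝔾⇒invariant d∣n Y∈𝔾)
... | b , |b|≡d , Y≡bᵠ = plusCount b , subst (plusCount b ≤_) |b|≡d (plusCount≤length b) ,
  trans (countPlus-periodic (suc q) b Y Y≡bᵠ) (sym ([q*d]*a/d≡q*a (suc q) d (plusCount b)))

leadingMinuses : (n k : ℕ) → Z2^ n
leadingMinuses zero    k       = Vec.[]
leadingMinuses (suc n) zero    = plus Vec.∷ leadingMinuses n zero
leadingMinuses (suc n) (suc k) = minus Vec.∷ leadingMinuses n k

countPlus-leadingMinuses : ∀ n k → countPlus (leadingMinuses n k) ≡ n ∸ k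
countPlus-leadingMinuses zero    zero    = refl
countPlus-leadingMinuses zero    (suc k) = refl
countPlus-leadingMinuses (suc n) zero    = cong suc (countPlus-leadingMinuses n zero)
countPlus-leadingMinuses (suc n) (suc k) = countPlus-leadingMinuses n k

countPlus-leadingMinuses-multiple : ∀ q d → countPlus (leadingMinuses (q * suc d) q) ≡ q * d
countPlus-leadingMinuses-multiple q d = begin
  countPlus (leadingMinuses (q * suc d) q) ≡⟨ countPlus-leadingMinuses (q * suc d) q ⟩
  q * suc d ∸ q                            ≡⟨ cong (_∸ q) (*-suc q d) ⟩
  q + q * d ∸ q                            ≡⟨ m+n∸m≡n q (q * d) ⟩
  q * d                                    ∎
  where open ≡-Reasoning

leadingMinuses∈UnionG : ∀ q d → UnionG (q * suc d) (suc d) (leadingMinuses (q * suc d) q)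
leadingMinuses∈UnionG q d =
  d , n≤1+n d , trans (countPlus-leadingMinuses-multiple q d) (sym ([q*d]*a/d≡q*a q (suc d) d))

leadingMinuses-not-invariant : ∀ q d → ¬ Invariant (2 + d) (leadingMinuses ((2 + q) * (2 + d)) (2 + q))
leadingMinuses-not-invariant q d inv with invariant⇒periodic (suc q) (2 + d) _ inv
... | []                    , ()     , _
... | _ ∷ []                , ()     , _
... | plus ∷ _ ∷ _          , _      , ()
... | minus ∷ plus ∷ _      , _      , ()
... | minus ∷ minus ∷ block , |b|≡2+d , Y≡bᵠ = 1+n≰n (*-cancelˡ-≤ (2 + q) (begin
  (2 + q) * suc d           ≡⟨ countPlus-leadingMinuses-multiple (2 + q) (suc d) ⟨
  countPlus Y               ≡⟨ countPlus-periodic (2 + q) (minus ∷ minus ∷ block) Y Y≡bᵠ ⟩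
  (2 + q) * plusCount block ≤⟨ *-monoʳ-≤ (2 + q) #block≤d ⟩
  (2 + q) * d               ∎))
  where
  open ≤-Reasoning
  Y : Z2^ ((2 + q) * (2 + d))
  Y = leadingMinuses ((2 + q) * (2 + d)) (2 + q)
  #block≤d : plusCount block ≤ d
  #block≤d = subst (plusCount block ≤_) (suc-injective (suc-injective |b|≡2+d)) (plusCount≤length block)

UnionG⊆𝔾⇒trivial : (n d : ℕ) .{{_ : NonZero d}} → 1 ≤ n → d ∣ n →
                   ((Y : Z2^ n) → UnionG n d Y → 𝔾 n d Y) → d ≡ 1 ⊎ d ≡ n
UnionG⊆𝔾⇒trivial _ zero _ _ _ = ⊥-elim (≢-nonZero⁻¹ 0 refl)
UnionG⊆𝔾⇒trivial _ 1 _ _ _ = inj₁ refl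
UnionG⊆𝔾⇒trivial .0 (suc (suc _)) () (divides zero refl)
UnionG⊆𝔾⇒trivial .(1 * d) d@(suc (suc _)) _ (divides 1 refl) _ = inj₂ (sym (*-identityˡ d))
UnionG⊆𝔾⇒trivial .(q * d) d@(suc (suc d′)) _ d∣n@(divides q@(suc (suc q′)) refl) UnionG⊆𝔾 =
  ⊥-elim (leadingMinuses-not-invariant q′ d′
    (𝔾⇒invariant d∣n (UnionG⊆𝔾 _ (leadingMinuses∈UnionG q (suc d′)))))

basis : (n k : ℕ) → Z2^ n
basis zero    k       = Vec.[]
basis (suc n) zero    = X (suc n)
basis (suc n) (suc k) = plus Vec.∷ basis n k

basis-≥ : ∀ n k → n ≤ k → basis n k ≡ one n
basis-≥ zero    k       _         = refl
basis-≥ (suc n) (suc k) (s≤s n≤k) = cong (plus Vec.∷_) (basis-≥ n k n≤k)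

prod-basis-suc : ∀ n ks → prod (map (basis (suc n)) (map suc ks)) ≡ plus Vec.∷ prod (map (basis n) ks)
prod-basis-suc n []       = refl
prod-basis-suc n (k ∷ ks) = cong ((plus Vec.∷ basis n k) ⊙_) (prod-basis-suc n ks)

basis-spans : (Y : Z2^ n) → ∃ λ ks → Y ≡ prod (map (basis n) ks)
basis-spans Vec.[] = [] , refl
basis-spans {suc n} (plus Vec.∷ Y) with basis-spans Y
... | ks , Y≡∏ks = map suc ks , trans (cong (plus Vec.∷_) Y≡∏ks) (sym (prod-basis-suc n ks))
basis-spans {suc n} (minus Vec.∷ Y) with basis-spans Y
... | ks , Y≡∏ks = 0 ∷ map suc ks , (begin
  minus Vec.∷ Y                                       ≡⟨ cong (minus Vec.∷_) (⊙-identityˡ Y) ⟨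
  X (suc n) ⊙ (plus Vec.∷ Y)                          ≡⟨ cong (λ Z → X (suc n) ⊙ (plus Vec.∷ Z)) Y≡∏ks ⟩
  X (suc n) ⊙ (plus Vec.∷ prod (map (basis n) ks))    ≡⟨ cong (X (suc n) ⊙_) (prod-basis-suc n ks) ⟨
  X (suc n) ⊙ prod (map (basis (suc n)) (map suc ks)) ∎)
  where open ≡-Reasoning

basis-∷ʳ : ∀ m k → k < m → basis m k ∷ʳ plus ≡ basis (suc m) k
basis-∷ʳ (suc m) zero    _         = cong (minus Vec.∷_) (replicate-∷ʳ m plus)
basis-∷ʳ (suc m) (suc k) (s≤s k<m) = cong (plus Vec.∷_) (basis-∷ʳ m k k<m)

C-basis : ∀ n k → suc k < n → C (basis n (suc k)) ≡ basis n k
C-basis (suc m) k (s≤s k<m) = basis-∷ʳ m k k<m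

C-X : ∀ m → C (X (suc m)) ≡ basis (suc m) m
C-X zero    = refl
C-X (suc m) = cong (plus Vec.∷_) (C-X m)

Cpow-X : ∀ j k → suc j + k ≡ n → Cpow (suc j) (X n) ≡ basis n k
Cpow-X zero    k refl = C-X k
Cpow-X {n} (suc j) k 2+j+k≡n = begin
  C (Cpow (suc j) (X n)) ≡⟨ cong C (Cpow-X j (suc k) (trans (cong suc (+-suc j k)) 2+j+k≡n)) ⟩
  C (basis n (suc k))    ≡⟨ C-basis n k (subst (suc k <_) 2+j+k≡n (s≤s (s≤s (m≤n+m k j)))) ⟩
  basis n k              ∎
  where open ≡-Reasoning

A-diagonal : ∀ n m .{{_ : NonZero n}} → A n n m ≡ Cpow m (X n)
A-diagonal n m = begin
  prod (map h (upTo (n / n))) ≡⟨ cong (λ q → prod (map h (upTo q))) (n/n≡1 n) ⟩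
  h 0 ⊙ one n                 ≡⟨ ⊙-identityʳ (h 0) ⟩
  Cpow (m + 0) (X n)          ≡⟨ cong (λ k → Cpow k (X n)) (+-identityʳ m) ⟩
  Cpow m (X n)                ∎
  where
  open ≡-Reasoning
  h : ℕ → Z2^ n
  h j = Cpow (m + j * n) (X n)

basis∈𝔾ₙ : ∀ n k .{{_ : NonZero n}} → 𝔾 n n (basis n k)
basis∈𝔾ₙ n k with k <? n
... | no  k≮n = subst (𝔾 n n) (sym (basis-≥ n k (≮⇒≥ k≮n))) unit
basis∈𝔾ₙ (suc m) zero    | yes 0<n = subst (𝔾 (suc m) (suc m)) (A-diagonal (suc m) 0) (gen 0 0<n)
basis∈𝔾ₙ n       (suc k) | yes k<n with m≤n⇒∃[o]m+o≡n k<n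
... | o , 2+k+o≡n =
  subst (𝔾 n n) (trans (A-diagonal n (suc o)) (Cpow-X o (suc k) 1+o+[1+k]≡n)) (gen (suc o) 1+o<n)
  where
  1+o+[1+k]≡n : suc o + suc k ≡ n
  1+o+[1+k]≡n = trans (cong suc (+-comm o (suc k))) 2+k+o≡n
  1+o<n : suc o < n
  1+o<n = subst (suc o <_) 2+k+o≡n (s≤s (s≤s (m≤n+m o k)))

𝔾ₙ-full : ∀ n .{{_ : NonZero n}} (Y : Z2^ n) → 𝔾 n n Y
𝔾ₙ-full n Y with basis-spans Y
... | ks , Y≡∏ks = subst (𝔾 n n) (sym Y≡∏ks) (prod∈𝔾 ks)
  where
  prod∈𝔾 : ∀ ks → 𝔾 n n (prod (map (basis n) ks))
  prod∈𝔾 []       = unit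
  prod∈𝔾 (k ∷ ks) = mul (basis∈𝔾ₙ n k) (prod∈𝔾 ks)

head-Cpow-X : ∀ j m → j < m → head (Cpow (suc j) (X (suc m))) ≡ plus
head-Cpow-X j m j<m with m≤n⇒∃[o]m+o≡n j<m
... | o , 1+j+o≡m = cong head (Cpow-X j (suc o) (cong suc (trans (+-suc j o) 1+j+o≡m)))

head-A₁ : ∀ m → head (A (suc m) 1 0) ≡ minus
head-A₁ m = begin
  head (prod (map h (upTo (suc m / 1))))
    ≡⟨ cong (λ q → head (prod (map h (upTo q)))) (n/1≡n (suc m)) ⟩
  head (X (suc m) ⊙ tail-prod)
    ≡⟨ head-⊙ (X (suc m)) tail-prod ⟩
  minus · head tail-prod
    ≡⟨ cong (minus ·_) (head-prod-plus _ (map⁺ (applyUpTo⁺₁ suc m head-h))) ⟩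
  minus ∎
  where
  open ≡-Reasoning
  h : ℕ → Z2^ (suc m)
  h j = Cpow (0 + j * 1) (X (suc m))
  tail-prod : Z2^ (suc m)
  tail-prod = prod (map h (applyUpTo suc m))
  head-h : ∀ {j} → j < m → head (h (suc j)) ≡ plus
  head-h {j} j<m =
    trans (cong (λ i → head (Cpow (suc i) (X (suc m)))) (*-identityʳ j)) (head-Cpow-X j m j<m)

A₁≡minus : ∀ m → A (suc m) 1 0 ≡ replicate (suc m) minus
A₁≡minus m = trans (C-fixed⇒constant (A (suc m) 1 0) (A-invariant (suc m) 1 (1∣ suc m) 0))
                   (cong (replicate (suc m)) (head-A₁ m))

countPlus≤n : (Y : Z2^ n) → countPlus Y ≤ n
countPlus≤n Vec.[]          = z≤n
countPlus≤n (plus Vec.∷ Y)  = s≤s (countPlus≤n Y)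
countPlus≤n (minus Vec.∷ Y) = m≤n⇒m≤1+n (countPlus≤n Y)

countPlus≡0⇒minus : (Y : Z2^ n) → countPlus Y ≡ 0 → Y ≡ replicate n minus
countPlus≡0⇒minus Vec.[]          _      = refl
countPlus≡0⇒minus (minus Vec.∷ Y) #Y≡0 = cong (minus Vec.∷_) (countPlus≡0⇒minus Y #Y≡0)

countPlus≡n⇒one : (Y : Z2^ n) → countPlus Y ≡ n → Y ≡ one n
countPlus≡n⇒one Vec.[]          _      = refl
countPlus≡n⇒one (plus Vec.∷ Y)  #Y≡1+n = cong (plus Vec.∷_) (countPlus≡n⇒one Y (suc-injective #Y≡1+n))
countPlus≡n⇒one (minus Vec.∷ Y) #Y≡1+n = ⊥-elim (1+n≰n (subst (_≤ _) #Y≡1+n (countPlus≤n Y)))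

UnionG₁⊆𝔾₁ : ∀ n → 1 ≤ n → (Y : Z2^ n) → UnionG n 1 Y → 𝔾 n 1 Y
UnionG₁⊆𝔾₁ (suc m) _ Y (0 , _ , #Y≡0) =
  subst (𝔾 (suc m) 1) (trans (A₁≡minus m) (sym (countPlus≡0⇒minus Y #Y≡0′))) (gen 0 (s≤s z≤n))
  where
  #Y≡0′ : countPlus Y ≡ 0
  #Y≡0′ = trans #Y≡0 (trans (n/1≡n (suc m * 0)) (*-zeroʳ (suc m)))
UnionG₁⊆𝔾₁ n _ Y (1 , _ , #Y≡n) =
  subst (𝔾 n 1) (sym (countPlus≡n⇒one Y (trans #Y≡n (trans (n/1≡n (n * 1)) (*-identityʳ n))))) unit
UnionG₁⊆𝔾₁ n _ Y (suc (suc a) , s≤s () , _)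

trivial⇒UnionG⊆𝔾 : (n d : ℕ) .{{_ : NonZero d}} → 1 ≤ n → (d ≡ 1 ⊎ d ≡ n) →
                   (Y : Z2^ n) → UnionG n d Y → 𝔾 n d Y
trivial⇒UnionG⊆𝔾 n .1 1≤n (inj₁ refl) = UnionG₁⊆𝔾₁ n 1≤n
trivial⇒UnionG⊆𝔾 n .n _   (inj₂ refl) Y _ = 𝔾ₙ-full n Y

mainTheorem10 : (n d : ℕ) .{{_ : NonZero d}} → 1 ≤ n → d ∣ n →
    ((Y : Z2^ n) → 𝔾 n d Y → UnionG n d Y)
    × ((((Y : Z2^ n) → UnionG n d Y → 𝔾 n d Y) → (d ≡ 1 ⊎ d ≡ n))
       × ((d ≡ 1 ⊎ d ≡ n) → ((Y : Z2^ n) → UnionG n d Y → 𝔾 n d Y)))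
mainTheorem10 n d 1≤n d∣n =
  𝔾⊆UnionG n d 1≤n d∣n , UnionG⊆𝔾⇒trivial n d 1≤n d∣n , trivial⇒UnionG⊆𝔾 n d 1≤n
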